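{- Let $\ell \geq 2$ and let $G$ be a $K_{\ell}$-critical graph with chromatic number $k$ such that $G$ is not isomorphic to $K_k$. Then there exists a copy $S$ of $K_{\ell+1}$ in $G$ such that for every vertex $x \in V(S)$ there is a copy $L$ of $K_{\ell}$ in $G$ with $V(L) \not\subseteq N[x]$.
   Context: All graphs are finite and simple. $N(x)$ is the neighborhood of $x$ and $N[x] = N(x) \cup \{x\}$. For $\ell \geq 2$, a graph $G$ is called $K_{\ell}$-critical if (i) $G$ contains $K_{\ell}$ as a subgraph; (ii) $G$ is critical, i.e. removing any vertex reduces the chromatic number of $G$ by one; (iii) removing the vertex set of any copy of $K_{\ell}$ in $G$ reduces the chromatic number of $G$ by exactly $\ell$. -}

module Defs where

open import Data.Nat using (ℕ; _≤_; _∸_)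
open import Data.Fin using (Fin; _≟_)
open import Data.Bool using (Bool; true; false; not)
open import Data.Unit using (⊤)
open import Data.Sum using (_⊎_)
open import Data.Product using (Σ; _×_; ∃; ∃-syntax; _,_)
open import Relation.Binary.PropositionalEquality using (_≡_; _≢_; refl; sym)
open import Relation.Nullary using (¬_; yes; no)
open import Relation.Nullary.Decidable using (⌊_⌋)
open import Function.Bundles using (_↔_; Inverse; _⇔_)

record Graph (n : ℕ) : Set where
  field
    adj    : Fin n → Fin n → Bool
    adj-sym    : ∀ u v → adj u v ≡ adj v u
    adj-irrefl : ∀ v → adj v v ≡ false

open Graph public

module _ {n : ℕ} (G : Graph n) where

  Adj : Fin n → Fin n → Set
  Adj u v = adj G u v ≡ true

  VSet : Set₁
  VSet = Fin n → Set

  Colorable : VSet → ℕ → Set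
  Colorable S m = Σ (Fin n → Fin m) λ c →
    ∀ u v → S u → S v → Adj u v → c u ≢ c v

  ChromaticNumberOn : VSet → ℕ → Set
  ChromaticNumberOn S k = Colorable S k × (∀ m → Colorable S m → k ≤ m)

  ChromaticNumber : ℕ → Set
  ChromaticNumber k = ChromaticNumberOn (λ _ → ⊤) k

  record Clique (ℓ : ℕ) : Set where
    field
      vtx       : Fin ℓ → Fin n
      injective : ∀ i j → vtx i ≡ vtx j → i ≡ j
      complete  : ∀ i j → i ≢ j → Adj (vtx i) (vtx j)

  open Clique public

  InClique : ∀ {ℓ} → Clique ℓ → VSet
  InClique K v = ∃[ i ] vtx K i ≡ v

  MinusVertex : Fin n → VSet
  MinusVertex x v = v ≢ x

  MinusClique : ∀ {ℓ} → Clique ℓ → VSet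
  MinusClique K v = ¬ InClique K v

  ClosedNbhd : Fin n → VSet
  ClosedNbhd x v = (v ≡ x) ⊎ Adj x v

  KCriticalWithχ : ℕ → ℕ → Set
  KCriticalWithχ ℓ k =
    ChromaticNumber k
    × Clique ℓ
    × (∀ x → ChromaticNumberOn (MinusVertex x) (k ∸ 1))
    × (∀ (K : Clique ℓ) → ChromaticNumberOn (MinusClique K) (k ∸ ℓ))

private
  neqb : ∀ {k} → Fin k → Fin k → Bool
  neqb u v = not ⌊ u ≟ v ⌋

  neqb-sym : ∀ {k} (u v : Fin k) → neqb u v ≡ neqb v u
  neqb-sym u v with u ≟ v | v ≟ u
  ... | yes _ | yes _ = refl
  ... | no _  | no _  = refl
  ... | yes p | no q  = Data.Empty.⊥-elim (q (sym p)) where import Data.Empty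
  ... | no p  | yes q = Data.Empty.⊥-elim (p (sym q)) where import Data.Empty

  neqb-irr : ∀ {k} (v : Fin k) → neqb v v ≡ false
  neqb-irr v with v ≟ v
  ... | yes _ = refl
  ... | no p  = Data.Empty.⊥-elim (p refl) where import Data.Empty

CompleteGraph : (k : ℕ) → Graph k
CompleteGraph k = record { adj = neqb ; adj-sym = neqb-sym ; adj-irrefl = neqb-irr }

Isomorphic : ∀ {n m} → Graph n → Graph m → Set
Isomorphic {n} {m} G H = Σ (Fin n ↔ Fin m) λ f →
  ∀ u v → adj G u v ≡ adj H (Inverse.to f u) (Inverse.to f v)

-- Fix a copy L of K_ℓ and a (k-ℓ)-colouring of G - V(L). Every colour class contains a
-- common neighbour of L: otherwise each vertex of that class could take the colour of a
-- vertex of L it misses, and G would be (k-1)-colourable. If two such representatives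
-- are non-adjacent, exchanging one of them for a vertex of L yields a copy of K_ℓ that the
-- other one misses. If instead all of them are pairwise adjacent, together with L they form
-- a copy of K_k, which by vertex-criticality contains every vertex, so G ≅ K_k. Hence every
-- copy of K_ℓ has a common neighbour that misses some copy of K_ℓ. Pushing such a vertex
-- into the clique ℓ times, each time dropping the oldest vertex, produces a copy of K_ℓ
-- whose vertices all miss some copy of K_ℓ; one more common neighbour extends it to S.
module Submission where

open import Defs
open import Data.Nat using (ℕ; suc; zero; _≤_; _<_; _∸_; _+_; s≤s)
open import Data.Nat.Properties using (1+n≰n; m+[n∸m]≡n)
open import Data.Fin using (Fin; zero; suc; toℕ; inject₁; splitAt; join; punchOut; _≟_)
open import Data.Fin.Properties
  using (any?; all?; suc-injective; inject₁-injective; toℕ-inject₁; toℕ<n; +↔⊎;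
         punchOut-injective; injective⇒≤; ¬∀⟶∃¬)
open import Data.Vec.Functional using (_∷_; _++_)
open import Data.Bool using (true; not)
import Data.Bool.Properties as Bool
open import Data.Product using (Σ; _×_; ∃; ∃-syntax; _,_; proj₁; proj₂)
open import Data.Sum using (_⊎_; inj₁; inj₂; [_,_])
open import Data.Sum.Properties using (inj₂-injective)
open import Data.Unit using (⊤; tt)
open import Data.Empty using (⊥-elim)
open import Function using (_∘_)
open import Function.Bundles using (Injection; mk↔ₛ′)
open import Function.Definitions using (Injective)
open import Function.Properties.Inverse using (↔-sym; ↔⇒↣)
open import Relation.Nullary using (¬_; Dec; yes; no; ¬?; _×-dec_)
open import Relation.Nullary.Decidable using (⌊_⌋; decidable-stable)
open import Relation.Binary.PropositionalEquality
  using (_≡_; _≢_; refl; sym; trans; cong; cong₂; subst; module ≡-Reasoning)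
open ≡-Reasoning

join-injective : ∀ a b → Injective _≡_ _≡_ (join a b)
join-injective a b = Injection.injective (↔⇒↣ (↔-sym (+↔⊎ {a} {b})))

splitAt-injective : ∀ a b → Injective _≡_ _≡_ (splitAt a {b})
splitAt-injective a b = Injection.injective (↔⇒↣ (+↔⊎ {a} {b}))

module _ {n : ℕ} (G : Graph n) where

  Adj? : ∀ u v → Dec (Adj G u v)
  Adj? u v = adj G u v Bool.≟ true

  Adj-irrefl : ∀ {v} → ¬ Adj G v v
  Adj-irrefl {v} a with trans (sym (adj-irrefl G v)) a
  ... | ()

  Adj-sym : ∀ {u v} → Adj G u v → Adj G v u
  Adj-sym {u} {v} = trans (adj-sym G v u)

  Adj⇒≢ : ∀ {u v} → Adj G u v → u ≢ v
  Adj⇒≢ a refl = Adj-irrefl a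

  Proper : ∀ {C : Set} → VSet G → (Fin n → C) → Set
  Proper S c = ∀ u v → S u → S v → Adj G u v → c u ≢ c v

  Proper-∘ : ∀ {C D : Set} {S : VSet G} {c : Fin n → C} (f : C → D) →
             Injective _≡_ _≡_ f → Proper S c → Proper S (f ∘ c)
  Proper-∘ f f-inj c-proper u v u∈S v∈S uv = c-proper u v u∈S v∈S uv ∘ f-inj

  unusedColour⇒Colorable : ∀ {N} {S : VSet G} (c : Fin n → Fin (suc N)) → Proper S c →
                           (a : Fin (suc N)) → (∀ v → a ≢ c v) → Colorable G S N
  unusedColour⇒Colorable c c-proper a unused =
    (λ v → punchOut (unused v)) ,
    λ u v u∈S v∈S uv → c-proper u v u∈S v∈S uv ∘ punchOut-injective (unused u) (unused v)

  CompleteTo : ∀ {N} → Clique G N → Fin n → Set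
  CompleteTo K w = ∀ i → Adj G w (vtx K i)

  CompleteTo? : ∀ {N} (K : Clique G N) w → Dec (CompleteTo K w)
  CompleteTo? K w = all? (λ i → Adj? w (vtx K i))

  InClique? : ∀ {N} (K : Clique G N) v → Dec (InClique G K v)
  InClique? K v = any? (λ i → vtx K i ≟ v)

  mkClique : ∀ {N} (f : Fin N → Fin n) → (∀ i j → i ≢ j → Adj G (f i) (f j)) → Clique G N
  mkClique f f-complete = record { vtx = f ; injective = f-injective ; complete = f-complete }
    where
    f-injective : ∀ i j → f i ≡ f j → i ≡ j
    f-injective i j fi≡fj with i ≟ j
    ... | yes i≡j = i≡j
    ... | no i≢j = ⊥-elim (Adj⇒≢ (f-complete i j i≢j) fi≡fj)

  subclique : ∀ {N M} (K : Clique G N) (f : Fin M → Fin N) → Injective _≡_ _≡_ f → Clique G M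
  subclique K f f-inj = mkClique (vtx K ∘ f) (λ i j i≢j → complete K (f i) (f j) (i≢j ∘ f-inj))

  tail : ∀ {N} → Clique G (suc N) → Clique G N
  tail K = subclique K suc suc-injective

  init : ∀ {N} → Clique G (suc N) → Clique G N
  init K = subclique K inject₁ inject₁-injective

  extend : ∀ {N} (w : Fin n) (K : Clique G N) → CompleteTo K w → Clique G (suc N)
  extend w K wK = mkClique (w ∷ vtx K) adjacent
    where
    adjacent : ∀ i j → i ≢ j → Adj G ((w ∷ vtx K) i) ((w ∷ vtx K) j)
    adjacent zero    zero    i≢j = ⊥-elim (i≢j refl)
    adjacent zero    (suc j) _   = wK j
    adjacent (suc i) zero    _   = Adj-sym (wK i)
    adjacent (suc i) (suc j) i≢j = complete K i j (i≢j ∘ cong suc)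

  union : ∀ {N M} (K₁ : Clique G N) (K₂ : Clique G M) →
          (∀ i j → Adj G (vtx K₁ i) (vtx K₂ j)) → Clique G (N + M)
  union {N} {M} K₁ K₂ cross =
    mkClique (vtx K₁ ++ vtx K₂) (λ i j i≢j → adjacent (splitAt N i) (splitAt N j) (i≢j ∘ splitAt-injective N M))
    where
    adjacent : ∀ x y → x ≢ y → Adj G ([ vtx K₁ , vtx K₂ ] x) ([ vtx K₁ , vtx K₂ ] y)
    adjacent (inj₁ i) (inj₁ j) x≢y = complete K₁ i j (x≢y ∘ cong inj₁)
    adjacent (inj₁ i) (inj₂ j) _   = cross i j
    adjacent (inj₂ j) (inj₁ i) _   = Adj-sym (cross i j)
    adjacent (inj₂ i) (inj₂ j) x≢y = complete K₂ i j (x≢y ∘ cong inj₂)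

  cliqueSize≤colours : ∀ {N M} {S : VSet G} (K : Clique G N) → (∀ i → S (vtx K i)) →
                       Colorable G S M → N ≤ M
  cliqueSize≤colours {S = S} K K⊆S (c , c-proper) = injective⇒≤ colours-distinct
    where
    colours-distinct : Injective _≡_ _≡_ (c ∘ vtx K)
    colours-distinct {i} {j} same with i ≟ j
    ... | yes i≡j = i≡j
    ... | no i≢j = ⊥-elim (c-proper _ _ (K⊆S i) (K⊆S j) (complete K i j i≢j) same)

  spanningClique⇒≅K : ∀ {N} (K : Clique G N) → (∀ v → InClique G K v) →
                      Isomorphic G (CompleteGraph N)
  spanningClique⇒≅K {N} K spans = mk↔ₛ′ index (vtx K) index-vtx vtx-index , adjacency
    where
    index : Fin n → Fin N
    index v = proj₁ (spans v)

    vtx-index : ∀ v → vtx K (index v) ≡ v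
    vtx-index v = proj₂ (spans v)

    index-vtx : ∀ i → index (vtx K i) ≡ i
    index-vtx i = injective K _ _ (vtx-index (vtx K i))

    adj-vtx : ∀ i j → adj G (vtx K i) (vtx K j) ≡ not ⌊ i ≟ j ⌋
    adj-vtx i j with i ≟ j
    ... | yes refl = adj-irrefl G (vtx K i)
    ... | no i≢j = complete K i j i≢j

    adjacency : ∀ u v → adj G u v ≡ adj (CompleteGraph N) (index u) (index v)
    adjacency u v = begin
      adj G u v                               ≡⟨ cong₂ (adj G) (sym (vtx-index u)) (sym (vtx-index v)) ⟩
      adj G (vtx K (index u)) (vtx K (index v)) ≡⟨ adj-vtx (index u) (index v) ⟩
      adj (CompleteGraph N) (index u) (index v) ∎

  module Recolouring {N m} (K : Clique G (suc N)) (c : Fin n → Fin m)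
                     (c-proper : Proper (MinusClique G K) c) (a : Fin m)
                     (noneComplete : ∀ w → c w ≡ a → ¬ CompleteTo K w) where

    data ColourOf (v : Fin n) : Fin (suc N) ⊎ Fin m → Set where
      inK   : ∀ i → vtx K i ≡ v → ColourOf v (inj₁ i)
      kept  : ¬ InClique G K v → c v ≢ a → ColourOf v (inj₂ (c v))
      moved : ∀ i → ¬ InClique G K v → c v ≡ a → ¬ Adj G v (vtx K i) → ColourOf v (inj₁ i)

    colourOf : ∀ v → ∃ (ColourOf v)
    colourOf v with InClique? K v
    ... | yes (i , vtx≡v) = inj₁ i , inK i vtx≡v
    ... | no v∉K with c v ≟ a
    ...   | no cv≢a = inj₂ (c v) , kept v∉K cv≢a
    ...   | yes cv≡a with ¬∀⟶∃¬ _ _ (λ i → Adj? v (vtx K i)) (noneComplete v cv≡a)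
    ...     | i , v≁i = inj₁ i , moved i v∉K cv≡a v≁i

    colourOf-proper : ∀ {u v x y} → ColourOf u x → ColourOf v y → Adj G u v → x ≢ y
    colourOf-proper (inK i refl)       (inK .i refl)       uv refl = Adj-irrefl uv
    colourOf-proper (inK i refl)       (moved .i _ _ v≁i)  uv refl = v≁i (Adj-sym uv)
    colourOf-proper (moved i _ _ u≁i)  (inK .i refl)       uv refl = u≁i uv
    colourOf-proper (kept u∉K _)       (kept v∉K _)        uv eq   =
      c-proper _ _ u∉K v∉K uv (inj₂-injective eq)
    colourOf-proper (moved _ u∉K cu _) (moved _ v∉K cv _)  uv _    =
      c-proper _ _ u∉K v∉K uv (trans cu (sym cv))
    colourOf-proper (inK _ _)          (kept _ _)          _  ()
    colourOf-proper (kept _ _)         (inK _ _)           _  ()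
    colourOf-proper (kept _ _)         (moved _ _ _ _)     _  ()
    colourOf-proper (moved _ _ _ _)    (kept _ _)          _  ()

    a-unused : ∀ {v x} → ColourOf v x → inj₂ a ≢ x
    a-unused (kept _ cv≢a) = cv≢a ∘ sym ∘ inj₂-injective
    a-unused (inK _ _)       ()
    a-unused (moved _ _ _ _) ()

    recoloured : Colorable G (λ _ → ⊤) (N + m)
    recoloured =
      unusedColour⇒Colorable (join (suc N) m ∘ proj₁ ∘ colourOf)
        (Proper-∘ (join (suc N) m) (join-injective (suc N) m)
          (λ u v _ _ → colourOf-proper (proj₂ (colourOf u)) (proj₂ (colourOf v))))
        (join (suc N) m (inj₂ a))
        (λ v → a-unused (proj₂ (colourOf v)) ∘ join-injective (suc N) m)

  noCompleteOfColour⇒Colorable : ∀ {N m} (K : Clique G (suc N)) (c : Fin n → Fin m) →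
    Proper (MinusClique G K) c → (a : Fin m) → (∀ w → c w ≡ a → ¬ CompleteTo K w) →
    Colorable G (λ _ → ⊤) (N + m)
  noCompleteOfColour⇒Colorable K c c-proper a noneComplete =
    Recolouring.recoloured K c c-proper a noneComplete

  MissesClique : ℕ → Fin n → Set
  MissesClique ℓ x = Σ (Clique G ℓ) λ L → ∃[ j ] ¬ ClosedNbhd G x (vtx L j)

module KCritical {n : ℕ} (G : Graph n) (ℓ-1 k : ℕ)
  (χ : ChromaticNumber G k)
  (vertexCritical : ∀ x → ChromaticNumberOn G (MinusVertex G x) (k ∸ 1))
  (cliqueCritical : ∀ (K : Clique G (suc ℓ-1)) → ChromaticNumberOn G (MinusClique G K) (k ∸ suc ℓ-1))
  (G≇Kₖ : ¬ Isomorphic G (CompleteGraph k)) where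

  private
    ℓ : ℕ
    ℓ = suc ℓ-1

  module _ (L : Clique G ℓ) where

    private
      m : ℕ
      m = k ∸ ℓ

      c : Fin n → Fin m
      c = proj₁ (proj₁ (cliqueCritical L))

      ℓ+m≡k : ℓ + m ≡ k
      ℓ+m≡k = m+[n∸m]≡n (cliqueSize≤colours G L (λ _ → tt) (proj₁ χ))

    colourClassMeetsCommonNbhd : ∀ a → ∃ λ w → c w ≡ a × CompleteTo G L w
    colourClassMeetsCommonNbhd a with any? (λ w → (c w ≟ a) ×-dec CompleteTo? G L w)
    ... | yes found = found
    ... | no none = ⊥-elim (1+n≰n (subst (_≤ ℓ-1 + m) (sym ℓ+m≡k) (proj₂ χ _ recoloured)))
      where
      recoloured : Colorable G (λ _ → ⊤) (ℓ-1 + m)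
      recoloured = noCompleteOfColour⇒Colorable G L c (proj₂ (proj₁ (cliqueCritical L))) a
                     (λ w cw≡a wL → none (w , cw≡a , wL))

    private
      rep : Fin m → Fin n
      rep a = proj₁ (colourClassMeetsCommonNbhd a)

      rep-complete : ∀ a → CompleteTo G L (rep a)
      rep-complete a = proj₂ (proj₂ (colourClassMeetsCommonNbhd a))

      rep-injective : Injective _≡_ _≡_ rep
      rep-injective {a} {b} same = begin
        a           ≡⟨ sym (proj₁ (proj₂ (colourClassMeetsCommonNbhd a))) ⟩
        c (rep a)   ≡⟨ cong c same ⟩
        c (rep b)   ≡⟨ proj₁ (proj₂ (colourClassMeetsCommonNbhd b)) ⟩
        b           ∎

    commonNbhdMissingClique : ∃ λ w → CompleteTo G L w × MissesClique G ℓ w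
    commonNbhdMissingClique
      with any? (λ a → any? (λ b → ¬? (a ≟ b) ×-dec ¬? (Adj? G (rep a) (rep b))))
    ... | yes (a , b , a≢b , a≁b) =
      rep a , rep-complete a , (extend G (rep b) (tail G L) (rep-complete b ∘ suc) , zero , b∉N[a])
      where
      b∉N[a] : ¬ ClosedNbhd G (rep a) (rep b)
      b∉N[a] = [ a≢b ∘ sym ∘ rep-injective , a≁b ]
    ... | no allAdjacent =
      ⊥-elim (G≇Kₖ (subst (λ N → Isomorphic G (CompleteGraph N)) ℓ+m≡k (spanningClique⇒≅K G Q spans)))
      where
      reps : Clique G m
      reps = mkClique G rep λ a b a≢b →
        decidable-stable (Adj? G (rep a) (rep b)) (λ a≁b → allAdjacent (a , b , a≢b , a≁b))

      Q : Clique G (ℓ + m)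
      Q = union G L reps (λ i a → Adj-sym G (rep-complete a i))

      spans : ∀ v → InClique G Q v
      spans v = decidable-stable (InClique? G Q v) λ v∉Q →
        1+n≰n (subst (ℓ + m ≤_) (cong (_∸ 1) (sym ℓ+m≡k))
          (cliqueSize≤colours G Q (λ i Qi≡v → v∉Q (i , Qi≡v)) (proj₁ (vertexCritical v))))

  cliqueMissingPrefix : Clique G ℓ → ∀ p →
    Σ (Clique G ℓ) λ L → ∀ i → toℕ i < p → MissesClique G ℓ (vtx L i)
  cliqueMissingPrefix L₀ zero = L₀ , λ _ ()
  cliqueMissingPrefix L₀ (suc p) with cliqueMissingPrefix L₀ p
  ... | L , prefix with commonNbhdMissingClique L
  ...   | w , wL , w-misses = extend G w (init G L) (wL ∘ inject₁) , misses
    where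
    misses : ∀ i → toℕ i < suc p → MissesClique G ℓ (vtx (extend G w (init G L) (wL ∘ inject₁)) i)
    misses zero    _         = w-misses
    misses (suc i) (s≤s i<p) = prefix (inject₁ i) (subst (_< p) (sym (toℕ-inject₁ i)) i<p)

  cliqueOfMissingVertices : Clique G ℓ → Σ (Clique G (suc ℓ)) λ S → ∀ i → MissesClique G ℓ (vtx S i)
  cliqueOfMissingVertices L₀ with cliqueMissingPrefix L₀ ℓ
  ... | L , allMiss with commonNbhdMissingClique L
  ...   | w , wL , w-misses = extend G w L wL , misses
    where
    misses : ∀ i → MissesClique G ℓ (vtx (extend G w L wL) i)
    misses zero    = w-misses
    misses (suc i) = allMiss i (toℕ<n i)

lemma5 : (ℓ : ℕ) → 2 ≤ ℓ → (n k : ℕ) → (G : Graph n) →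
    KCriticalWithχ G ℓ k → ¬ Isomorphic G (CompleteGraph k) →
    Σ (Clique G (suc ℓ)) λ S →
    ∀ (i : Fin (suc ℓ)) →
    Σ (Clique G ℓ) λ L → ∃[ j ] ¬ ClosedNbhd G (vtx S i) (vtx L j)
lemma5 zero () _ _ _ _ _
lemma5 (suc ℓ-1) _ n k G (χ , L₀ , vertexCritical , cliqueCritical) G≇Kₖ =
  KCritical.cliqueOfMissingVertices G ℓ-1 k χ vertexCritical cliqueCritical G≇Kₖ L₀
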